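{- Let $H$ be a 3-uniform hypergraph, let $x,y\in V(H)$ be distinct, and let $S\subseteq V(H)\setminus \{x,y\}$. Let $L_x=L_x(H,S,y)$ and $L_y=L_y(H,S,x)$. If there exists a set $D\subseteq S$ of size $t$ such that $D$ is dominated in both $L_x$ and $L_y$, then $H$ contains $K_{2,t}$ as a trace.
   Context: Graphs here may have loops (possibly several at a vertex). In such a graph $G$, a set $D\subseteq V(G)$ is dominated if every $v\in D$ either has a loop or has a neighbor outside $D$. For a 3-uniform hypergraph $H$, distinct $x,y\in V(H)$ and $S\subseteq V(H)\setminus\{x,y\}$, the graph $L_x(H,S,y)$ has vertex set $S$, an edge $uv$ for $u,v\in S$ whenever $\{u,v,x\}\in E(H)$, and a loop at $u\in S$ for each edge $\{u,v,x\}\in E(H)$ with $v\notin S\cup\{y\}$; $L_y(H,S,x)$ is defined symmetrically with the roles of $x$ and $y$ exchanged. A 3-uniform hypergraph $H$ contains $K_{2,t}$ as a trace if there exist distinct vertices $x,y,u_1,\dots,u_t$ and $2t$ distinct edges $e_{x,1},\dots,e_{x,t},e_{y,1},\dots,e_{y,t}$ of $H$ such that, with $S'=\{x,y,u_1,\dots,u_t\}$, we have $e_{x,i}\cap S'=\{x,u_i\}$ and $e_{y,i}\cap S'=\{y,u_i\}$ for all $i$. -}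

module Defs where

open import Data.Nat using (ℕ)
open import Data.Fin using (Fin)
open import Data.Fin.Subset using (Subset; ⁅_⁆; _∪_; _∈_; _∉_; _⊆_; ∣_∣)
open import Data.Product using (Σ; ∃; _×_; _,_)
open import Data.Sum using (_⊎_)
open import Relation.Binary.PropositionalEquality using (_≡_; _≢_)
open import Relation.Nullary using (¬_)
open import Function.Bundles using (_⇔_)

record Hypergraph3 (n : ℕ) : Set₁ where
  field
    isEdge  : Subset n → Set
    uniform : ∀ e → isEdge e → ∣ e ∣ ≡ 3
open Hypergraph3 public

triple : ∀ {n} → Fin n → Fin n → Fin n → Subset n
triple a b c = ⁅ a ⁆ ∪ ⁅ b ⁆ ∪ ⁅ c ⁆

-- A graph (possibly with loops) whose vertex set is a subset V of Fin n.
-- Only the existence of a loop matters for domination, so loops are a predicate.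
record LoopGraph (n : ℕ) : Set₁ where
  field
    verts : Subset n
    adj   : Fin n → Fin n → Set
    loop  : Fin n → Set
open LoopGraph public

Lgraph : ∀ {n} → Hypergraph3 n → (x : Fin n) → (S : Subset n) → (y : Fin n) → LoopGraph n
Lgraph H x S y = record
  { verts = S
  ; adj   = λ u v → u ∈ S × v ∈ S × isEdge H (triple u v x)
  ; loop  = λ u → u ∈ S × Σ _ (λ v → v ∉ S × v ≢ y × isEdge H (triple u v x))
  }

Dominated : ∀ {n} → LoopGraph n → Subset n → Set
Dominated G D = ∀ v → v ∈ D →
  loop G v ⊎ Σ _ (λ w → w ∈ verts G × w ∉ D × adj G v w)

ContainsK2tTrace : ∀ {n} → Hypergraph3 n → ℕ → Set
ContainsK2tTrace {n} H t =
  Σ (Fin n) λ x → Σ (Fin n) λ y → Σ (Fin t → Fin n) λ u →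
  Σ (Fin t → Subset n) λ ex → Σ (Fin t → Subset n) λ ey →
    x ≢ y × (∀ i → u i ≢ x) × (∀ i → u i ≢ y) × (∀ i j → u i ≡ u j → i ≡ j)
    × (∀ i → isEdge H (ex i)) × (∀ i → isEdge H (ey i))
    × (∀ i j → ex i ≡ ex j → i ≡ j) × (∀ i j → ey i ≡ ey j → i ≡ j)
    × (∀ i j → ex i ≢ ey j)
    × (∀ i w → (w ∈ ex i × InS' x y u w) ⇔ (w ≡ x ⊎ w ≡ u i))
    × (∀ i w → (w ∈ ey i × InS' x y u w) ⇔ (w ≡ y ⊎ w ≡ u i))
  where
  InS' : Fin n → Fin n → (Fin t → Fin n) → Fin n → Set
  InS' x y u w = w ≡ x ⊎ w ≡ y ⊎ Σ (Fin t) (λ j → w ≡ u j)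

-- Enumerate D as u_1, ..., u_t. Domination of D in L_x gives, for each u_i, an edge
-- {u_i, c, x} of H whose third vertex c lies outside D and differs from y (a loop
-- supplies c ∉ S ∪ {y}, a neighbour supplies c ∈ S ∖ D); take it as e_{x,i}, and
-- symmetrically e_{y,i} from L_y. Since c is neither y nor any u_j, each e_{x,i} meets
-- {x, y, u_1, ..., u_t} exactly in {x, u_i}; the vertex u_i (resp. x) then tells the
-- edges apart.
module Submission where

open import Defs
open import Data.Nat using (ℕ)
open import Data.Fin using (Fin; zero; suc)
open import Data.Fin.Properties using (suc-injective)
open import Data.Fin.Subset using (Subset; _∈_; _∉_; _⊆_; ∣_∣; ⁅_⁆; inside; outside)
open import Data.Fin.Subset.Properties using (x∈⁅x⁆; x∈⁅y⁆⇒x≡y; x∈p∪q⁻; x∈p∪q⁺)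
open import Data.Vec using (_∷_; here; there)
open import Data.Product using (Σ; _×_; _,_)
open import Data.Sum as Sum using (_⊎_; inj₁; inj₂)
open import Data.Empty using (⊥-elim)
open import Relation.Binary.PropositionalEquality using (_≡_; _≢_; refl; sym; trans; cong; subst)
open import Function.Bundles using (_⇔_; mk⇔)

private
  variable
    n : ℕ

∈-triple⁻ : ∀ {a b c w : Fin n} → w ∈ triple a b c → w ≡ a ⊎ w ≡ b ⊎ w ≡ c
∈-triple⁻ {a = a} {b} {c} w∈abc with x∈p∪q⁻ ⁅ a ⁆ _ w∈abc
... | inj₁ w∈a = inj₁ (x∈⁅y⁆⇒x≡y a w∈a)
... | inj₂ w∈bc with x∈p∪q⁻ ⁅ b ⁆ ⁅ c ⁆ w∈bc
...   | inj₁ w∈b = inj₂ (inj₁ (x∈⁅y⁆⇒x≡y b w∈b))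
...   | inj₂ w∈c = inj₂ (inj₂ (x∈⁅y⁆⇒x≡y c w∈c))

∈-triple-first : (a b c : Fin n) → a ∈ triple a b c
∈-triple-first a b c = x∈p∪q⁺ (inj₁ (x∈⁅x⁆ a))

∈-triple-third : (a b c : Fin n) → c ∈ triple a b c
∈-triple-third a b c = x∈p∪q⁺ (inj₂ (x∈p∪q⁺ (inj₂ (x∈⁅x⁆ c))))

enumerate : (D : Subset n) → Fin ∣ D ∣ → Fin n
enumerate (outside ∷ D) i       = suc (enumerate D i)
enumerate (inside  ∷ D) zero    = zero
enumerate (inside  ∷ D) (suc i) = suc (enumerate D i)

enumerate-∈ : (D : Subset n) (i : Fin ∣ D ∣) → enumerate D i ∈ D
enumerate-∈ (outside ∷ D) i       = there (enumerate-∈ D i)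
enumerate-∈ (inside  ∷ D) zero    = here
enumerate-∈ (inside  ∷ D) (suc i) = there (enumerate-∈ D i)

enumerate-injective : (D : Subset n) (i j : Fin ∣ D ∣) → enumerate D i ≡ enumerate D j → i ≡ j
enumerate-injective (outside ∷ D) i       j       eq = enumerate-injective D i j (suc-injective eq)
enumerate-injective (inside  ∷ D) zero    zero    eq = refl
enumerate-injective (inside  ∷ D) (suc i) (suc j) eq =
  cong suc (enumerate-injective D i j (suc-injective eq))

record ExitEdge (H : Hypergraph3 n) (D : Subset n) (a b v : Fin n) : Set where
  field
    third   : Fin n
    third∉D : third ∉ D
    third≢b : third ≢ b
    isEdge  : Hypergraph3.isEdge H (triple v third a)

  edge : Subset n
  edge = triple v third a

open ExitEdge

dominated⇒exitEdge : ∀ (H : Hypergraph3 n) {a b S D v} → b ∉ S → D ⊆ S →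
  Dominated (Lgraph H a S b) D → v ∈ D → ExitEdge H D a b v
dominated⇒exitEdge H b∉S D⊆S dom v∈D with dom _ v∈D
... | inj₁ (_ , c , c∉S , c≢b , e) = record
  { third = c ; third∉D = λ c∈D → c∉S (D⊆S c∈D) ; third≢b = c≢b ; isEdge = e }
... | inj₂ (c , c∈S , c∉D , _ , _ , e) = record
  { third = c ; third∉D = c∉D ; third≢b = λ { refl → b∉S c∈S } ; isEdge = e }

module _ {H : Hypergraph3 n} {D : Subset n} where

  exitEdge-≡⇒≡ : ∀ {a b b′ v v′} (E : ExitEdge H D a b v) (E′ : ExitEdge H D a b′ v′) →
    a ∉ D → v ∈ D → edge E ≡ edge E′ → v ≡ v′
  exitEdge-≡⇒≡ {a = a} {v = v} E E′ a∉D v∈D eq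
    with ∈-triple⁻ (subst (v ∈_) eq (∈-triple-first v (third E) a))
  ... | inj₁ v≡v′         = v≡v′
  ... | inj₂ (inj₁ v≡c′)  = ⊥-elim (third∉D E′ (subst (_∈ D) v≡c′ v∈D))
  ... | inj₂ (inj₂ v≡a)   = ⊥-elim (a∉D (subst (_∈ D) v≡a v∈D))

  exitEdges-apart : ∀ {a b v v′} (E : ExitEdge H D a b v) (E′ : ExitEdge H D b a v′) →
    a ≢ b → a ∉ D → v′ ∈ D → edge E ≢ edge E′
  exitEdges-apart {a = a} {v = v} E E′ a≢b a∉D v′∈D eq
    with ∈-triple⁻ (subst (a ∈_) eq (∈-triple-third v (third E) a))
  ... | inj₁ a≡v′        = a∉D (subst (_∈ D) (sym a≡v′) v′∈D)
  ... | inj₂ (inj₁ a≡c′) = third≢b E′ (sym a≡c′)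
  ... | inj₂ (inj₂ a≡b)  = a≢b a≡b

  exitEdge-trace : ∀ {a b v w} (E : ExitEdge H D a b v) →
    w ∈ edge E → w ≡ a ⊎ w ≡ b ⊎ w ∈ D → w ≡ a ⊎ w ≡ v
  exitEdge-trace E w∈e w∈abD with ∈-triple⁻ w∈e | w∈abD
  ... | inj₁ w≡v        | _                  = inj₂ w≡v
  ... | inj₂ (inj₂ w≡a) | _                  = inj₁ w≡a
  ... | inj₂ (inj₁ _)   | inj₁ w≡a           = inj₁ w≡a
  ... | inj₂ (inj₁ w≡c) | inj₂ (inj₁ w≡b)    = ⊥-elim (third≢b E (trans (sym w≡c) w≡b))
  ... | inj₂ (inj₁ w≡c) | inj₂ (inj₂ w∈D)    = ⊥-elim (third∉D E (subst (_∈ D) w≡c w∈D))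

dominatedTwice⇒K2tTrace : ∀ (H : Hypergraph3 n) {x y S D} → x ≢ y → x ∉ S → y ∉ S → D ⊆ S →
  Dominated (Lgraph H x S y) D → Dominated (Lgraph H y S x) D → ContainsK2tTrace H ∣ D ∣
dominatedTwice⇒K2tTrace {n} H {x} {y} {_} {D} x≢y x∉S y∉S D⊆S dom-x dom-y =
  x , y , u , (λ i → edge (X i)) , (λ i → edge (Y i))
  , x≢y , (λ i eq → x∉D (subst (_∈ D) eq (u∈D i))) , (λ i eq → y∉D (subst (_∈ D) eq (u∈D i)))
  , enumerate-injective D
  , (λ i → isEdge (X i)) , (λ i → isEdge (Y i))
  , (λ i j eq → enumerate-injective D i j (exitEdge-≡⇒≡ (X i) (X j) x∉D (u∈D i) eq))
  , (λ i j eq → enumerate-injective D i j (exitEdge-≡⇒≡ (Y i) (Y j) y∉D (u∈D i) eq))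
  , (λ i j → exitEdges-apart (X i) (Y j) x≢y x∉D (u∈D j))
  , (λ i _ → trace⇔ (X i) S′⇒x,y,D (inj₁ refl))
  , (λ i _ → trace⇔ (Y i) S′⇒y,x,D (inj₂ (inj₁ refl)))
  where
  u : Fin ∣ D ∣ → Fin n
  u = enumerate D
  u∈D : ∀ i → u i ∈ D
  u∈D = enumerate-∈ D
  x∉D : x ∉ D
  x∉D x∈D = x∉S (D⊆S x∈D)
  y∉D : y ∉ D
  y∉D y∈D = y∉S (D⊆S y∈D)
  X : ∀ i → ExitEdge H D x y (u i)
  X i = dominated⇒exitEdge H y∉S D⊆S dom-x (u∈D i)
  Y : ∀ i → ExitEdge H D y x (u i)
  Y i = dominated⇒exitEdge H x∉S D⊆S dom-y (u∈D i)

  S′ : Fin n → Set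
  S′ w = w ≡ x ⊎ w ≡ y ⊎ Σ (Fin ∣ D ∣) (λ j → w ≡ u j)
  S′⇒x,y,D : ∀ {w} → S′ w → w ≡ x ⊎ w ≡ y ⊎ w ∈ D
  S′⇒x,y,D = Sum.map₂ (Sum.map₂ (λ { (j , refl) → u∈D j }))
  S′⇒y,x,D : ∀ {w} → S′ w → w ≡ y ⊎ w ≡ x ⊎ w ∈ D
  S′⇒y,x,D w∈S′ with S′⇒x,y,D w∈S′
  ... | inj₁ w≡x         = inj₂ (inj₁ w≡x)
  ... | inj₂ (inj₁ w≡y)  = inj₁ w≡y
  ... | inj₂ (inj₂ w∈D)  = inj₂ (inj₂ w∈D)

  trace⇔ : ∀ {a b i w} (E : ExitEdge H D a b (u i)) →
    (∀ {w} → S′ w → w ≡ a ⊎ w ≡ b ⊎ w ∈ D) → S′ a → (w ∈ edge E × S′ w) ⇔ (w ≡ a ⊎ w ≡ u i)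
  trace⇔ {a} {i = i} E S′⇒a,b,D a∈S′ = mk⇔ (λ (w∈e , w∈S′) → exitEdge-trace E w∈e (S′⇒a,b,D w∈S′)) from
    where
    from : ∀ {w} → w ≡ a ⊎ w ≡ u i → w ∈ edge E × S′ w
    from (inj₁ refl) = ∈-triple-third (u i) (third E) a , a∈S′
    from (inj₂ refl) = ∈-triple-first (u i) (third E) a , inj₂ (inj₂ (i , refl))

lemma4p1 : ∀ {n} (H : Hypergraph3 n) (x y : Fin n) (S : Subset n) (t : ℕ) →
    x ≢ y → x ∉ S → y ∉ S →
    Σ (Subset n) (λ D → D ⊆ S × ∣ D ∣ ≡ t
      × Dominated (Lgraph H x S y) D × Dominated (Lgraph H y S x) D) →
    ContainsK2tTrace H t
lemma4p1 H x y S .(∣ D ∣) x≢y x∉S y∉S (D , D⊆S , refl , dom-x , dom-y) =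
  dominatedTwice⇒K2tTrace H x≢y x∉S y∉S D⊆S dom-x dom-y
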